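{- Let $\mathbb{S}$ be a set of symbolic events, each $x\in\mathbb{S}$ having a Boolean guard $g(x)$ (a formula over the symbols of a formula $\mathsf{ssa}$) and a clock variable $\mathrm{clk}(x)$ ranging over $\mathbb{N}$. For $x,y\in\mathbb{S}$ let $c_{xy}$ be the formula $(g(x)\wedge g(y))\Rightarrow \mathrm{clk}(x)<\mathrm{clk}(y)$, and for a relation $r\subseteq \mathbb{S}\times\mathbb{S}$ let $\phi(r)=\bigwedge_{(x,y)\in r} c_{xy}$. Let $V$ be a valuation of the symbols of $\mathsf{ssa}$, and let $\mathrm{conc}(r,V)$ be the relation on concrete events consisting of (the concretisations of) those pairs $(x,y)\in r$ for which both $g(x)$ and $g(y)$ evaluate to true under $V$. Then: (i) if $C$ is a valuation of the clock variables such that $(C,V)$ satisfies $\phi(r)$, then $\mathrm{conc}(r,V)$ is acyclic and has finite prefixes; and (ii) conversely, if $\mathrm{conc}(r,V)$ is acyclic and has finite prefixes, then there exists a valuation $C$ of the clock variables such that $(C,V)$ satisfies $\phi(r)$.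
   Context: A prefix of an element $x$ in a relation $R$ is a (possibly infinite) list $S=[x_0,x_1,x_2,\dots]$ with $x_0=x$ and $(x_{i+1},x_i)\in R$ for all $i$. Its cardinality $\mathrm{card}(S)$ is the number of distinct elements occurring in it. $R$ has finite prefixes if for every $x$ there is $l\in\mathbb{N}$ such that every prefix $S$ of $x$ in $R$ satisfies $\mathrm{card}(S)<l$. A relation is acyclic if its transitive closure is irreflexive. "$(C,V)$ satisfies a formula" means the formula evaluates to true when clock variables are interpreted by $C$ and all other symbols by $V$. -}

module Defs where

open import Level using (0ℓ)
open import Data.Nat using (ℕ; zero; suc; _<_)
open import Data.Fin using (Fin)
open import Data.Bool using (Bool; true; _∧_)
open import Data.Unit using (⊤)
open import Data.Product using (Σ; ∃; _×_)
open import Relation.Binary.PropositionalEquality using (_≡_; _≢_)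
open import Relation.Binary.Core using (Rel)
open import Relation.Binary.Construct.Closure.Transitive using (TransClosure)
open import Relation.Nullary using (¬_)

Acyclic : {E : Set} → Rel E 0ℓ → Set
Acyclic {E} R = (x : E) → ¬ TransClosure R x x

data Length : Set where
  fin : ℕ → Length
  ∞   : Length

_<ᴸ_ : ℕ → Length → Set
i <ᴸ fin n = i < n
i <ᴸ ∞     = ⊤

-- A prefix of x in R: a (possibly infinite) list [x₀, x₁, …] with x₀ = x
-- and (x_{i+1}, x_i) ∈ R for all i; represented by its length and the
-- sequence of its entries (entries beyond the length are irrelevant).
record Prefix {E : Set} (R : Rel E 0ℓ) (x : E) : Set where
  field
    len      : Length
    seq      : ℕ → E
    nonempty : 0 <ᴸ len
    head     : seq 0 ≡ x
    step     : (i : ℕ) → suc i <ᴸ len → R (seq (suc i)) (seq i)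
open Prefix public

-- card(P) ≥ l : P contains at least l pairwise distinct elements
-- (there are l positions of P carrying pairwise distinct entries).
CardGE : {E : Set} {R : Rel E 0ℓ} {x : E} → Prefix R x → ℕ → Set
CardGE P l =
  Σ (Fin l → ℕ) λ pos →
    ((j : Fin l) → pos j <ᴸ len P) ×
    ((j k : Fin l) → j ≢ k → seq P (pos j) ≢ seq P (pos k))

CardLT : {E : Set} {R : Rel E 0ℓ} {x : E} → Prefix R x → ℕ → Set
CardLT P l = ¬ CardGE P l

FinitePrefixes : {E : Set} → Rel E 0ℓ → Set
FinitePrefixes {E} R = (x : E) → ∃ λ l → (P : Prefix R x) → CardLT P l

-- Concretisation of r under V: the pairs of r whose both guards hold
-- under V (concrete events are identified with the enabled symbolic ones).
conc : {S Val : Set} → (S → Val → Bool) → Rel S 0ℓ → Val → Rel S 0ℓ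
conc g r V x y = r x y × (g x V ≡ true) × (g y V ≡ true)

SatC : {S Val Clk : Set} → (S → Val → Bool) → (S → Clk) →
       (Clk → ℕ) → Val → S → S → Set
SatC g clk C V x y = (g x V ∧ g y V) ≡ true → C (clk x) < C (clk y)

SatPhi : {S Val Clk : Set} → (S → Val → Bool) → (S → Clk) →
         Rel S 0ℓ → (Clk → ℕ) → Val → Set
SatPhi g clk r C V = ∀ x y → r x y → SatC g clk C V x y

module Submission where

-- Both directions
-- go through the notion of a *ranking* of R: a map f into ℕ that strictly
-- increases along every edge of R.
--
--  * A ranking rules out cycles (f would increase around a cycle), and it
--    bounds the positions of any prefix of x by f x, so by pigeonhole no
--    prefix of x has more than f x + 1 distinct entries.
--  * Conversely (classically), in an acyclic relation the entries of a
--    prefix are pairwise distinct, so finite prefixes bound the length of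
--    every prefix of x; the *height* of x, the greatest number of edges of a
--    prefix ending at x, then exists and is a ranking.
--  * A valuation C satisfies φ(r) iff C ∘ clk is a ranking of R, and since
--    clk is injective every ranking factors as C ∘ clk (classically).

open import Defs
open import Level using (0ℓ)
open import Data.Nat using (ℕ; zero; suc; _+_; _≤_; _<_; z≤n; s≤s; _<?_)
open import Data.Nat.Properties
open import Data.Bool using (Bool; true; _∧_)
open import Data.Unit using (tt)
open import Data.Fin using (Fin; toℕ; fromℕ<)
import Data.Fin.Properties as Fin
open import Data.Empty using (⊥-elim)
open import Data.Product using (∃; _×_; _,_; proj₁; proj₂; Σ)
open import Data.Sum using (_⊎_; inj₁; inj₂)
open import Relation.Binary.Core using (Rel)
open import Relation.Binary.Definitions using (tri<; tri≈; tri>)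
open import Relation.Binary.PropositionalEquality
  using (_≡_; _≢_; refl; sym; trans; cong; subst; subst₂)
open import Relation.Binary.Construct.Closure.Transitive using (TransClosure; [_]; _∷_)
open import Relation.Nullary using (yes; no)
open import Function.Definitions using (Injective)
open import Axiom.ExcludedMiddle using (ExcludedMiddle)

<ᴸ-≤ : ∀ {i j L} → i ≤ j → j <ᴸ L → i <ᴸ L
<ᴸ-≤ {L = fin n} i≤j j<n = ≤-<-trans i≤j j<n
<ᴸ-≤ {L = ∞}     _   _   = tt

<ᴸ-pred : ∀ {i L} → suc i <ᴸ L → i <ᴸ L
<ᴸ-pred = <ᴸ-≤ (n≤1+n _)

∧-true : ∀ {a b} → (a ∧ b) ≡ true → a ≡ true × b ≡ true
∧-true {true} b≡true = refl , b≡true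

true-∧ : ∀ {a b} → a ≡ true → b ≡ true → (a ∧ b) ≡ true
true-∧ refl b≡true = b≡true

module _ {E : Set} {R : Rel E 0ℓ} where

  prefix-chain : ∀ {x} (P : Prefix R x) i j → i < j → j <ᴸ len P →
                 TransClosure R (seq P j) (seq P i)
  prefix-chain P i (suc j) (s≤s i≤j) valid with m≤n⇒m<n∨m≡n i≤j
  ... | inj₂ refl = [ step P j valid ]
  ... | inj₁ i<j  = step P j valid ∷ prefix-chain P i j i<j (<ᴸ-pred valid)

  acyclic⇒prefix-distinct : Acyclic R → ∀ {x} (P : Prefix R x) i j →
                            i < j → j <ᴸ len P → seq P i ≢ seq P j
  acyclic⇒prefix-distinct acyclic P i j i<j valid eq =
    acyclic (seq P i)
      (subst (λ z → TransClosure R z (seq P i)) (sym eq) (prefix-chain P i j i<j valid))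

  acyclic⇒long-prefix-card : Acyclic R → ∀ {x} (P : Prefix R x) l →
                             (∀ i → i < l → i <ᴸ len P) → CardGE P l
  acyclic⇒long-prefix-card acyclic P l valid =
    toℕ , (λ j → valid (toℕ j) (Fin.toℕ<n j)) , distinct
    where
    distinct : (j k : Fin l) → j ≢ k → seq P (toℕ j) ≢ seq P (toℕ k)
    distinct j k j≢k with <-cmp (toℕ j) (toℕ k)
    ... | tri< j<k _ _ = acyclic⇒prefix-distinct acyclic P _ _ j<k (valid _ (Fin.toℕ<n k))
    ... | tri≈ _ j≡k _ = ⊥-elim (j≢k (Fin.toℕ-injective j≡k))
    ... | tri> _ _ k<j = λ eq →
      acyclic⇒prefix-distinct acyclic P _ _ k<j (valid _ (Fin.toℕ<n j)) (sym eq)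

  bounded-positions⇒card : ∀ {x} (P : Prefix R x) n →
                           (∀ i → i <ᴸ len P → i < n) → CardLT P (suc n)
  bounded-positions⇒card P n bounded (pos , valid , distinct)
    with Fin.pigeonhole (n<1+n n) (λ j → fromℕ< (bounded (pos j) (valid j)))
  ... | a , b , a<b , same-slot = distinct a b (λ a≡b → <-irrefl (cong toℕ a≡b) a<b)
                                    (cong (seq P) same-position)
    where
    same-position : pos a ≡ pos b
    same-position = trans (sym (Fin.toℕ-fromℕ< _))
                          (trans (cong toℕ same-slot) (Fin.toℕ-fromℕ< _))

  Ranking : (E → ℕ) → Set
  Ranking f = ∀ {x y} → R x y → f x < f y

  ranking-trans : ∀ {f} → Ranking f → ∀ {x y} → TransClosure R x y → f x < f y
  ranking-trans rank [ xRy ]      = rank xRy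
  ranking-trans rank (xRy ∷ yR⁺z) = <-trans (rank xRy) (ranking-trans rank yR⁺z)

  ranking⇒acyclic : ∀ {f} → Ranking f → Acyclic R
  ranking⇒acyclic rank x cycle = <-irrefl refl (ranking-trans rank cycle)

  ranking-descent : ∀ {f} → Ranking f → ∀ {x} (P : Prefix R x) i →
                    i <ᴸ len P → f (seq P i) + i ≤ f x
  ranking-descent {f} rank P zero _ =
    ≤-reflexive (trans (+-identityʳ _) (cong f (head P)))
  ranking-descent {f} rank P (suc i) valid = begin
    f (seq P (suc i)) + suc i  ≡⟨ +-suc _ i ⟩
    suc (f (seq P (suc i)) + i) ≤⟨ +-monoˡ-≤ i (rank (step P i valid)) ⟩
    f (seq P i) + i            ≤⟨ ranking-descent rank P i (<ᴸ-pred valid) ⟩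
    f _                        ∎
    where open ≤-Reasoning

  -- Positions of a prefix of x lie below f x + 1, so it has < f x + 2 entries.
  ranking⇒finitePrefixes : ∀ {f} → Ranking f → FinitePrefixes R
  ranking⇒finitePrefixes {f} rank x =
    suc (suc (f x)) , λ P → bounded-positions⇒card P (suc (f x))
      (λ i valid → s≤s (≤-trans (m≤n+m i _) (ranking-descent rank P i valid)))

-- Classically, the greatest m ≤ k satisfying Q (or 0 if there is none).
module GreatestBelow (lem : ExcludedMiddle 0ℓ) (Q : ℕ → Set) where

  greatestBelow : ℕ → ℕ
  greatestBelow zero = zero
  greatestBelow (suc k) with lem {Q (suc k)}
  ... | yes _ = suc k
  ... | no  _ = greatestBelow k

  greatestBelow-greatest : ∀ {m} k → Q m → m ≤ k → m ≤ greatestBelow k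
  greatestBelow-greatest zero    _  z≤n = z≤n
  greatestBelow-greatest (suc k) qm m≤1+k with lem {Q (suc k)}
  ... | yes _ = m≤1+k
  ... | no ¬q with m≤n⇒m<n∨m≡n m≤1+k
  ...   | inj₁ (s≤s m≤k) = greatestBelow-greatest k qm m≤k
  ...   | inj₂ refl      = ⊥-elim (¬q qm)

  greatestBelow-sound : ∀ k → greatestBelow k ≡ 0 ⊎ Q (greatestBelow k)
  greatestBelow-sound zero = inj₁ refl
  greatestBelow-sound (suc k) with lem {Q (suc k)}
  ... | yes q = inj₂ q
  ... | no  _ = greatestBelow-sound k

-- Classically, an acyclic relation with finite prefixes has a ranking:
-- the height of x, the greatest number of R-steps in a prefix of x.
module Height {E : Set} {R : Rel E 0ℓ} (lem : ExcludedMiddle 0ℓ)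
              (acyclic : Acyclic R) (finite : FinitePrefixes R) where

  -- x has a prefix consisting of exactly n steps (n + 1 entries).
  HasChain : E → ℕ → Set
  HasChain x n = Σ (Prefix R x) λ P → len P ≡ fin (suc n)

  trivial-chain : ∀ x → HasChain x 0
  trivial-chain x =
    record { len = fin 1 ; seq = λ _ → x ; nonempty = s≤s z≤n ; head = refl
           ; step = λ { _ (s≤s ()) } } , refl

  extend-chain : ∀ {x y n} → R x y → HasChain x n → HasChain y (suc n)
  extend-chain {x} {y} {n} xRy (P , len≡) =
    record { len = fin (suc (suc n)) ; seq = entries ; nonempty = s≤s z≤n
           ; head = refl ; step = steps } , refl
    where
    entries : ℕ → E
    entries zero    = y
    entries (suc i) = seq P i
    steps : ∀ i → suc i <ᴸ fin (suc (suc n)) → R (entries (suc i)) (entries i)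
    steps zero    _       = subst (λ z → R z y) (sym (head P)) xRy
    steps (suc i) (s≤s v) = step P i (subst (suc i <ᴸ_) (sym len≡) v)

  bound : E → ℕ
  bound x = proj₁ (finite x)

  -- Entries of a chain are distinct, so its length is below the bound.
  chain-bounded : ∀ {x n} → HasChain x n → n < bound x
  chain-bounded {x} {n} (P , len≡) with suc n <? bound x
  ... | yes 1+n<bound = <-trans (n<1+n n) 1+n<bound
  ... | no  1+n≮bound = ⊥-elim (proj₂ (finite x) P
          (acyclic⇒long-prefix-card acyclic P (bound x) λ i i<bound →
             subst (i <ᴸ_) (sym len≡) (<-≤-trans i<bound (≮⇒≥ 1+n≮bound))))

  open GreatestBelow lem

  height : E → ℕ
  height x = greatestBelow (HasChain x) (bound x)

  -- The height is realised by a chain and dominates every chain length,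
  -- so an edge x R y gives a chain of height x + 1 steps ending at y.
  height-attained : ∀ x → HasChain x (height x)
  height-attained x with greatestBelow-sound (HasChain x) (bound x)
  ... | inj₁ h≡0 = subst (HasChain x) (sym h≡0) (trivial-chain x)
  ... | inj₂ q   = q

  height-maximal : ∀ {x n} → HasChain x n → n ≤ height x
  height-maximal {x} q = greatestBelow-greatest (HasChain x) (bound x) q (<⇒≤ (chain-bounded q))

  height-ranking : Ranking {R = R} height
  height-ranking xRy = height-maximal (extend-chain xRy (height-attained _))

module Factor {S Clk : Set} (lem : ExcludedMiddle 0ℓ) (clk : S → Clk)
              (clk-injective : Injective _≡_ _≡_ clk) (f : S → ℕ) where

  factor : Clk → ℕ
  factor c with lem {∃ λ x → clk x ≡ c}
  ... | yes (x , _) = f x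
  ... | no  _       = 0

  factor-clk : ∀ x → factor (clk x) ≡ f x
  factor-clk x with lem {∃ λ x′ → clk x′ ≡ clk x}
  ... | yes (x′ , clk-eq) = cong f (clk-injective clk-eq)
  ... | no  ¬preimage     = ⊥-elim (¬preimage (x , refl))

module _ {S Val Clk : Set} (g : S → Val → Bool) (clk : S → Clk)
         (r : Rel S 0ℓ) (V : Val) where

  satPhi⇒ranking : ∀ C → SatPhi g clk r C V → Ranking {R = conc g r V} (λ x → C (clk x))
  satPhi⇒ranking C sat (xry , gx , gy) = sat _ _ xry (true-∧ gx gy)

  ranking⇒satPhi : ∀ C → Ranking {R = conc g r V} (λ x → C (clk x)) → SatPhi g clk r C V
  ranking⇒satPhi C rank x y xry gxy = rank (xry , ∧-true gxy)

lemma1 : {S Val Clk : Set} (g : S → Val → Bool) (clk : S → Clk)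
         → Injective _≡_ _≡_ clk
         → (r : Rel S 0ℓ) (V : Val)
         → ((C : Clk → ℕ) → SatPhi g clk r C V
             → Acyclic (conc g r V) × FinitePrefixes (conc g r V))
           × (ExcludedMiddle 0ℓ
             → Acyclic (conc g r V) × FinitePrefixes (conc g r V)
             → ∃ λ (C : Clk → ℕ) → SatPhi g clk r C V)
lemma1 g clk clk-injective r V = sound , complete
  where
  sound : ∀ C → SatPhi g clk r C V → Acyclic (conc g r V) × FinitePrefixes (conc g r V)
  sound C sat = ranking⇒acyclic rank , ranking⇒finitePrefixes rank
    where rank = satPhi⇒ranking g clk r V C sat

  complete : ExcludedMiddle 0ℓ → Acyclic (conc g r V) × FinitePrefixes (conc g r V) →
             ∃ λ C → SatPhi g clk r C V
  complete lem (acyclic , finite) =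
    factor , ranking⇒satPhi g clk r V factor λ {x} {y} xRy →
      subst₂ _<_ (sym (factor-clk x)) (sym (factor-clk y)) (height-ranking xRy)
    where
    open Height lem acyclic finite
    open Factor lem clk clk-injective height
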